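{- Let $2\le k<g$ be integers with $(k+1)\nmid g$ (equivalently, $Y(g,k)$ is not a 1089 graph). Then every direct predecessor of the node $[0,0]$ in $Y(g,k)$ is an odd pivot node.
   Context: For integers $2\le k<g$, the labeled directed graph $H(g,k)$ has a distinguished starting node $[[0,0]]$ and other nodes labeled by pairs $[R,r]$ of integers with $0\le R,r\le k-1$ (the node $[0,0]$ is distinct from the starting node). For a node $[P,p]$ (the starting node treated as $[0,0]$ here) there is an edge labeled $(A,a)$ from $[P,p]$ to $[R,r]$ whenever $0\le A,a\le g-1$ are integers, $0\le R,r\le k-1$, $ka+p=A+rg$ and $kA+R=a+Pg$; edges leaving the starting node additionally require $A\ne0\ne a$; no edge enters the starting node. $H(g,k)$ consists of the starting node and all nodes reachable from it. An even pivot node is a node $[a,a]$; an odd pivot node is a node $[r,s]$ with an edge to $[s,r]$ (including $[a,a]$ with a self-loop); the starting node is not a pivot node. $Y(g,k)$ is obtained from $H(g,k)$ by deleting every node that is not a pivot node and from which no pivot node is reachable, with incident edges. A 1089 graph is a Young graph isomorphic (as an unlabeled directed graph, by a bijection preserving even and odd pivot nodes) to $Y(10,9)$. -}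

module Defs where

open import Data.Nat using (ℕ; zero; suc; _+_; _*_; _<_; _≤_)
open import Data.Fin using (Fin; toℕ; fromℕ<)
open import Data.Product using (Σ; _×_; ∃; ∃-syntax)
open import Data.Sum using (_⊎_)
open import Data.Empty using (⊥)
open import Data.Unit using (⊤)
open import Relation.Nullary using (¬_)
open import Relation.Binary.PropositionalEquality using (_≡_)
open import Relation.Binary.Construct.Closure.ReflexiveTransitive using (Star)

-- Nodes of H(g,k): the distinguished starting node [[0,0]], and the nodes [R,r]
-- with 0 ≤ R,r ≤ k-1.
data Node (k : ℕ) : Set where
  start : Node k
  nd    : Fin k → Fin k → Node k

fstN : ∀ {k} → Node k → ℕ
fstN start    = 0
fstN (nd P p) = toℕ P

sndN : ∀ {k} → Node k → ℕ
sndN start    = 0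
sndN (nd P p) = toℕ p

StartCond : ∀ {k} → Node k → ℕ → ℕ → Set
StartCond start    A a = ¬ (A ≡ 0) × ¬ (a ≡ 0)
StartCond (nd _ _) A a = ⊤

LabeledEdge : (g k : ℕ) → Node k → ℕ → ℕ → Node k → Set
LabeledEdge g k u A a start    = ⊥
LabeledEdge g k u A a (nd R r) =
  A < g × a < g
  × k * a + sndN u ≡ A + toℕ r * g
  × k * A + toℕ R ≡ a + fstN u * g
  × StartCond u A a

Edge : (g k : ℕ) → Node k → Node k → Set
Edge g k u v = ∃[ A ] ∃[ a ] LabeledEdge g k u A a v

Reach : (g k : ℕ) → Node k → Node k → Set
Reach g k = Star (Edge g k)

InH : (g k : ℕ) → Node k → Set
InH g k v = Reach g k start v

EvenPivot : ∀ {k} → Node k → Set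
EvenPivot start    = ⊥
EvenPivot (nd a b) = a ≡ b

OddPivot : (g k : ℕ) → Node k → Set
OddPivot g k start    = ⊥
OddPivot g k (nd r s) = Edge g k (nd r s) (nd s r)

Pivot : (g k : ℕ) → Node k → Set
Pivot g k v = EvenPivot v ⊎ OddPivot g k v

InY : (g k : ℕ) → Node k → Set
InY g k v = InH g k v × (Pivot g k v ⊎ ∃[ w ] (Reach g k v w × Pivot g k w))

origin : ∀ {k} → 0 < k → Node k
origin p = nd (fromℕ< p) (fromℕ< p)

-- u is a direct predecessor of v in Y(g,k): both are nodes of Y(g,k) and
-- there is an edge u → v (Y keeps all edges of H between surviving nodes)
DirectPred : (g k : ℕ) → Node k → Node k → Set
DirectPred g k u v = InY g k u × InY g k v × Edge g k u v

module Submission where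

-- Only the edge into [0,0] matters.  Write k = n + 2.  An edge labelled (A,a) from
-- a node u = [P,p] into [0,0] means  k·a + p = A  and  k·A = a + P·g.
--   * The starting node has no such edge: it would force k·a = A and k·A = a with
--     a ≠ 0, but then a + a ≤ k·a = A ≤ k·A = a.
--   * For u = [P,p], put b = A + a.  Adding the two equations gives
--     k·b + p = b + P·g, which is exactly the condition for an edge [P,p] → [p,P]
--     labelled (b,b) (both edge equations coincide for a swapped target).  It
--     remains to see b < g: if g ≤ b then (k-1)·b + p = P·g ≤ (k-1)·g ≤ (k-1)·b,
--     forcing p = 0 and b = g; but then g = b = k·a + a = (k+1)·a, contradicting
--     (k+1) ∤ g.

open import Defs
open import Data.Nat using (ℕ; suc; _≤_; _<_; s≤s; z≤n; _+_; _*_; _≤?_)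
open import Data.Nat.Properties
open import Data.Nat.Divisibility using (_∣_; divides)
open import Data.Fin using (Fin; toℕ)
open import Data.Fin.Properties using (toℕ<n)
open import Data.Product using (_×_; _,_; proj₁; proj₂)
open import Data.Empty using (⊥-elim)
open import Data.Unit using (tt)
open import Relation.Nullary using (¬_; yes; no)
open import Relation.Binary.PropositionalEquality
  using (_≡_; sym; trans; cong; cong₂; subst; module ≡-Reasoning)

mutual-multiples-vanish : ∀ n {A a} → suc (suc n) * a ≡ A → suc (suc n) * A ≡ a →
                          a ≡ 0
mutual-multiples-vanish n {A} {a} ka≡A kA≡a =
  n≤0⇒n≡0 (+-cancelˡ-≤ a a 0 (begin
    a + a              ≤⟨ +-monoʳ-≤ a (m≤m+n a (n * a)) ⟩
    suc (suc n) * a    ≡⟨ ka≡A ⟩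
    A                  ≤⟨ m≤n*m A (suc (suc n)) ⟩
    suc (suc n) * A    ≡⟨ kA≡a ⟩
    a                  ≡⟨ sym (+-identityʳ a) ⟩
    a + 0              ∎))
  where open ≤-Reasoning

swap-equation : ∀ k g P p A a → k * a + p ≡ A → k * A ≡ a + P * g →
                k * (A + a) + p ≡ A + a + P * g
swap-equation k g P p A a ka+p≡A kA≡a+Pg = begin
  k * (A + a) + p        ≡⟨ cong (_+ p) (*-distribˡ-+ k A a) ⟩
  k * A + k * a + p      ≡⟨ +-assoc (k * A) (k * a) p ⟩
  k * A + (k * a + p)    ≡⟨ cong₂ _+_ kA≡a+Pg ka+p≡A ⟩
  a + P * g + A          ≡⟨ +-comm (a + P * g) A ⟩
  A + (a + P * g)        ≡⟨ sym (+-assoc A a (P * g)) ⟩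
  A + a + P * g          ∎
  where open ≡-Reasoning

saturated : ∀ n {b p P g} → P ≤ suc n → suc n * b + p ≡ P * g → g ≤ b →
            b ≡ g × p ≡ 0
saturated n {b} {p} {P} {g} P≤m eq g≤b = ≤-antisym b≤g g≤b , p≡0
  where
  open ≤-Reasoning
  Pg≤mb : P * g ≤ suc n * b
  Pg≤mb = ≤-trans (*-monoˡ-≤ g P≤m) (*-monoʳ-≤ (suc n) g≤b)
  p≡0 : p ≡ 0
  p≡0 = n≤0⇒n≡0 (+-cancelˡ-≤ (suc n * b) p 0 (begin
    suc n * b + p  ≡⟨ eq ⟩
    P * g          ≤⟨ Pg≤mb ⟩
    suc n * b      ≡⟨ sym (+-identityʳ _) ⟩
    suc n * b + 0  ∎))
  b≤g : b ≤ g
  b≤g = *-cancelˡ-≤ (suc n) (begin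
    suc n * b      ≤⟨ m≤m+n (suc n * b) p ⟩
    suc n * b + p  ≡⟨ eq ⟩
    P * g          ≤⟨ *-monoˡ-≤ g P≤m ⟩
    suc n * g      ∎)

successor-divides : ∀ k a → suc k ∣ k * a + a
successor-divides k a = divides a (begin
  k * a + a    ≡⟨ +-comm (k * a) a ⟩
  a + k * a    ≡⟨ cong (a +_) (*-comm k a) ⟩
  a + a * k    ≡⟨ sym (*-suc a k) ⟩
  a * suc k    ∎)
  where open ≡-Reasoning

swap-label-bound : ∀ n {g P p A a} → ¬ (suc (suc (suc n)) ∣ g) → P ≤ suc n →
                   suc (suc n) * a + p ≡ A →
                   suc (suc n) * (A + a) + p ≡ A + a + P * g → A + a < g
swap-label-bound n {g} {P} {p} {A} {a} k+1∤g P≤ ka+p≡A eq with g ≤? A + a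
... | no g≰b = ≰⇒> g≰b
... | yes g≤b = ⊥-elim (k+1∤g (subst (_ ∣_) b≡g k+1∣b))
  where
  b = A + a
  reduced : suc n * b + p ≡ P * g
  reduced = +-cancelˡ-≡ b _ _ (trans (sym (+-assoc b (suc n * b) p)) eq)
  saturation : b ≡ g × p ≡ 0
  saturation = saturated n P≤ reduced g≤b
  b≡g : b ≡ g
  b≡g = proj₁ saturation
  ka≡A : suc (suc n) * a ≡ A
  ka≡A = trans (sym (+-identityʳ _))
               (subst (λ q → suc (suc n) * a + q ≡ A) (proj₂ saturation) ka+p≡A)
  k+1∣b : suc (suc (suc n)) ∣ b
  k+1∣b = subst (λ x → _ ∣ x + a) ka≡A (successor-divides (suc (suc n)) a)

no-start-edge-into-origin : ∀ n {g A a} {hz : 0 < suc (suc n)} →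
                            ¬ LabeledEdge g (suc (suc n)) start A a (origin hz)
no-start-edge-into-origin n {A = A} {a} (_ , _ , ka+0≡A+0 , kA+0≡a+0 , _ , a≢0) =
  a≢0 (mutual-multiples-vanish n (drop-zeros ka+0≡A+0) (drop-zeros kA+0≡a+0))
  where
  drop-zeros : ∀ {x y} → x + 0 ≡ y + 0 → x ≡ y
  drop-zeros {x} {y} eq = +-cancelʳ-≡ 0 x y eq

edge-into-origin⇒odd-pivot :
  ∀ n {g A a} {hz : 0 < suc (suc n)} (P p : Fin (suc (suc n))) →
  ¬ (suc (suc (suc n)) ∣ g) →
  LabeledEdge g (suc (suc n)) (nd P p) A a (origin hz) →
  OddPivot g (suc (suc n)) (nd P p)
edge-into-origin⇒odd-pivot n {g} {A} {a} P p k+1∤g (_ , _ , ka+p≡A , kA≡a+Pg , _) =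
  A + a , A + a , b<g , b<g , swapped , swapped , tt
  where
  k = suc (suc n)
  digit-eq : k * a + toℕ p ≡ A
  digit-eq = trans ka+p≡A (+-identityʳ A)
  carry-eq : k * A ≡ a + toℕ P * g
  carry-eq = trans (sym (+-identityʳ (k * A))) kA≡a+Pg
  swapped : k * (A + a) + toℕ p ≡ A + a + toℕ P * g
  swapped = swap-equation k g (toℕ P) (toℕ p) A a digit-eq carry-eq
  b<g : A + a < g
  b<g = swap-label-bound n k+1∤g (≤-pred (toℕ<n P)) digit-eq swapped

-- The corollary: a direct predecessor of [0,0] is not the starting node, hence an
-- odd pivot node.
corollary2 : (g k : ℕ) → (hk : 2 ≤ k) → k < g → ¬ (suc k ∣ g) →
    (u : Node k) → DirectPred g k u (origin (≤-trans (s≤s z≤n) hk)) →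
    OddPivot g k u
corollary2 g .(suc (suc n)) hk@(s≤s (s≤s {n = n} z≤n)) _ k+1∤g start
  (_ , _ , _ , _ , edge) =
  ⊥-elim (no-start-edge-into-origin n {hz = ≤-trans (s≤s z≤n) hk} edge)
corollary2 g .(suc (suc n)) hk@(s≤s (s≤s {n = n} z≤n)) _ k+1∤g (nd P p)
  (_ , _ , _ , _ , edge) =
  edge-into-origin⇒odd-pivot n {hz = ≤-trans (s≤s z≤n) hk} P p k+1∤g edge
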